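{- Let $n,k$ be positive integers with $n\ge 2k$. Then $Q(n,k)=\mathrm{SG}(n,k)$ if and only if $k=1$, $n=2k$, or $n=2k+1$. In particular, $\mathrm{SG}(n,k)$ is vertex-critical for the fractional chromatic number (i.e. deleting any vertex strictly decreases $\chi_f$) exactly in these cases.
   Context: For a positive integer $n$ let $[n]=\{1,\dots,n\}$ and let $C_n$ be the cycle on $[n]$ with edges $\{i,i+1\}$ ($1\le i\le n-1$) and $\{n,1\}$. The Schrijver graph $\mathrm{SG}(n,k)$ ($n\ge 2k$) has as vertices the $k$-subsets of $[n]$ containing no two cyclically consecutive elements, two vertices adjacent iff they are disjoint. An arc of $C_n$ is a set $\{i,i+1,\dots,i+m-1\}$ (addition mod $n$) with $1\le m\le n-1$. A set $U\subseteq[n]$ is well-spread if for any two arcs $A,B$ with $|A|=|B|$ we have $\big||A\cap U|-|B\cap U|\big|\le 1$. $Q(n,k)$ is the induced subgraph of $\mathrm{SG}(n,k)$ on all well-spread $k$-subsets of $[n]$. $\chi_f$ denotes the fractional chromatic number. -}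

module Defs where

open import Data.Nat using (ℕ; zero; suc; _+_; _*_; _∸_; _≤_; _<_; _<?_)
open import Data.Fin using (Fin; toℕ; fromℕ<)
import Data.Fin as F
open import Data.Fin.Subset using (Subset; _∈_; ∣_∣)
open import Data.Vec using (lookup)
open import Data.Bool using (Bool; true; false)
open import Data.Product using (Σ; _×_; ∃)
open import Data.Sum using (_⊎_)
open import Data.Empty using (⊥)
open import Relation.Nullary using (¬_; yes; no)
open import Relation.Binary.PropositionalEquality using (_≡_; _≢_)

-- Ground set [n] is represented by Fin n (element i ↔ i+1).
-- Cyclic successor on C_n: i ↦ i+1, and the last element ↦ the first.
csuc : ∀ {n} → Fin n → Fin n
csuc {suc n} i with suc (toℕ i) <? suc n
... | yes p = fromℕ< p
... | no _ = F.zero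

SGVertex : (n k : ℕ) → Subset n → Set
SGVertex n k S = (∣ S ∣ ≡ k) × (∀ (i : Fin n) → i ∈ S → csuc i ∈ S → ⊥)

b2n : Bool → ℕ
b2n true = 1
b2n false = 0

arcCount : ∀ {n} → Subset n → Fin n → ℕ → ℕ
arcCount U i zero = 0
arcCount U i (suc m) = b2n (lookup U i) + arcCount U (csuc i) m

WellSpread : (n : ℕ) → Subset n → Set
WellSpread n U = ∀ (i j : Fin n) (m : ℕ) → 1 ≤ m → m ≤ n ∸ 1 →
  arcCount U i m ≤ suc (arcCount U j m)

QVertex : (n k : ℕ) → Subset n → Set
QVertex n k S = SGVertex n k S × WellSpread n S

-- Q(n,k) = SG(n,k): Q is an induced subgraph of SG, so equality means equal vertex sets.
QEqualsSG : ℕ → ℕ → Set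
QEqualsSG n k = ∀ S → SGVertex n k S → QVertex n k S

Disjoint : ∀ {n} → Subset n → Subset n → Set
Disjoint A B = ∀ x → x ∈ A → x ∈ B → ⊥

-- Graphs considered: induced subgraphs of SG(n,k) given by a vertex predicate P
-- (adjacency = disjointness).
Colorable : (n : ℕ) → (Subset n → Set) → ℕ → ℕ → Set
Colorable n P a b = Σ (Subset n → Subset a) λ c →
  (∀ S → P S → ∣ c S ∣ ≡ b) ×
  (∀ S T → P S → P T → Disjoint S T → Disjoint (c S) (c T))

-- χ_f(G_P) < χ_f(G_P'), with χ_f(G) = min { a/b : G has an a:b-colouring, b ≥ 1 }
-- (the minimum is attained for finite graphs):
-- some a:b-colouring of G_P has a/b strictly below a'/b' for every a':b'-colouring of G_P'.
FracChiLt : (n : ℕ) → (Subset n → Set) → (Subset n → Set) → Set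
FracChiLt n P P' = Σ ℕ λ a → Σ ℕ λ b → (1 ≤ b) × Colorable n P a b ×
  (∀ a' b' → 1 ≤ b' → Colorable n P' a' b' → a * b' < a' * b)

FracVertexCritical : ℕ → ℕ → Set
FracVertexCritical n k = ∀ v → SGVertex n k v →
  FracChiLt n (λ S → SGVertex n k S × S ≢ v) (SGVertex n k)

{-# OPTIONS --safe #-}
-- Identify a subset U of [n] with its n-periodic 0/1 indicator ind U on ℕ, so that arcs of C_n
-- become windows. A vertex of SG(n,k) has no two consecutive elements, hence at most ⌈m/2⌉ of them
-- in a window of length m. For n ∈ {2k, 2k+1} this gives ⌈m/2⌉ + ⌈(n−m)/2⌉ ≤ k + 1 for an arc and
-- the complement of another arc of the same length, so every vertex is well-spread (for k = 1
-- every arc meets the vertex at most once). Otherwise the crowded vertex {0, 2, …, 2k−2} has arcs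
-- of length 3 meeting it in 2 and in 0 elements.
--
-- For χ_f, the circular vertices S_c = {y : (c + k y) mod n ≥ n − k} satisfy S_c ∩ S_{c+s} = ∅ for
-- k ≤ s ≤ n − k. By a Katona-type argument each colour class of an a:b-colouring contains at most k
-- of S_0, …, S_{n−1}, so every induced subgraph containing them has χ_f ≥ n/k, which the identity
-- n:k-colouring of SG(n,k) attains. The crowded vertex is not circular, so deleting it keeps
-- χ_f = n/k. In the exceptional cases SG(n,k) is K_n, K_2 or C_{2k+1}, and deleting any vertex v
-- leaves a graph with an explicit (n−1):1-, 1:1- or 2:1-colouring.
module Submission where

open import Data.Nat
  using (ℕ; zero; suc; _+_; _*_; _∸_; _≤_; _<_; z≤n; s≤s; z<s; s≤s⁻¹; _≤ᵇ_; _≟_; _<?_; ⌊_/2⌋; ⌈_/2⌉; NonZero)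
open import Data.Nat.Properties
open import Data.Nat.DivMod
open import Data.Nat.Tactic.RingSolver using (solve-∀)
open import Data.Fin as F using (Fin; toℕ; fromℕ<)
import Data.Fin.Properties as FP
open import Data.Fin.Subset using (Subset; _∈_; ∣_∣; ⁅_⁆)
open import Data.Fin.Subset.Properties using (∣⁅x⁆∣≡1; x∈⁅y⁆⇒x≡y)
open import Data.Vec using (Vec; []; _∷_; lookup; tabulate)
import Data.Vec.Properties as VP
open import Data.Bool using (Bool; true; false; _∧_; T)
import Data.Bool.Properties as BP
open import Data.Unit using (tt)
open import Data.Product using (_×_; _,_; ∃; proj₁; proj₂)
open import Data.Sum using (_⊎_; inj₁; inj₂)
open import Data.Empty using (⊥; ⊥-elim)
open import Relation.Nullary using (¬_; Dec; yes; no; does)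
open import Relation.Nullary.Decidable using (dec-true; dec-false)
open import Relation.Binary.PropositionalEquality
open import Function.Base using (_∘_)
open import Function.Bundles using (_⇔_; mk⇔)

open import Defs

sumFrom : (ℕ → ℕ) → ℕ → ℕ → ℕ
sumFrom f x zero    = 0
sumFrom f x (suc m) = f x + sumFrom f (suc x) m

private
  window-head : ∀ (R : ℕ → ℕ → Set) {f g : ℕ → ℕ} x y {m} →
    (∀ j → j < suc m → R (f (x + j)) (g (y + j))) → R (f x) (g y)
  window-head R {f} {g} x y h = subst₂ (λ a b → R (f a) (g b)) (+-identityʳ x) (+-identityʳ y) (h 0 z<s)

  window-tail : ∀ (R : ℕ → ℕ → Set) {f g : ℕ → ℕ} x y {m} →
    (∀ j → j < suc m → R (f (x + j)) (g (y + j))) →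
    ∀ j → j < m → R (f (suc x + j)) (g (suc y + j))
  window-tail R {f} {g} x y h j j<m = subst₂ (λ a b → R (f a) (g b)) (+-suc x j) (+-suc y j) (h (suc j) (s≤s j<m))

sumFrom-cong : ∀ f g x y m → (∀ j → j < m → f (x + j) ≡ g (y + j)) → sumFrom f x m ≡ sumFrom g y m
sumFrom-cong f g x y zero    h = refl
sumFrom-cong f g x y (suc m) h =
  cong₂ _+_ (window-head _≡_ {f} {g} x y h) (sumFrom-cong f g (suc x) (suc y) m (window-tail _≡_ {f} {g} x y h))

sumFrom-mono-≤ : ∀ f g x y m → (∀ j → j < m → f (x + j) ≤ g (y + j)) → sumFrom f x m ≤ sumFrom g y m
sumFrom-mono-≤ f g x y zero    h = z≤n
sumFrom-mono-≤ f g x y (suc m) h =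
  +-mono-≤ (window-head _≤_ {f} {g} x y h) (sumFrom-mono-≤ f g (suc x) (suc y) m (window-tail _≤_ {f} {g} x y h))

sumFrom-+ : ∀ f x m p → sumFrom f x (m + p) ≡ sumFrom f x m + sumFrom f (x + m) p
sumFrom-+ f x zero    p = cong (λ z → sumFrom f z p) (sym (+-identityʳ x))
sumFrom-+ f x (suc m) p = begin
    f x + sumFrom f (suc x) (m + p)                             ≡⟨ cong (f x +_) (sumFrom-+ f (suc x) m p) ⟩
    f x + (sumFrom f (suc x) m + sumFrom f (suc x + m) p)       ≡⟨ sym (+-assoc (f x) _ _) ⟩
    f x + sumFrom f (suc x) m + sumFrom f (suc x + m) p         ≡⟨ cong (λ z → f x + sumFrom f (suc x) m + sumFrom f z p) (sym (+-suc x m)) ⟩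
    f x + sumFrom f (suc x) m + sumFrom f (x + suc m) p         ∎
  where open ≡-Reasoning

sumFrom-distrib : ∀ f g x m → sumFrom (λ y → f y + g y) x m ≡ sumFrom f x m + sumFrom g x m
sumFrom-distrib f g x zero    = refl
sumFrom-distrib f g x (suc m) = begin
    f x + g x + sumFrom (λ y → f y + g y) (suc x) m    ≡⟨ cong (f x + g x +_) (sumFrom-distrib f g (suc x) m) ⟩
    f x + g x + (sumFrom f (suc x) m + sumFrom g (suc x) m) ≡⟨ +-+-comm (f x) (g x) _ _ ⟩
    f x + sumFrom f (suc x) m + (g x + sumFrom g (suc x) m) ∎
  where
  open ≡-Reasoning
  +-+-comm : ∀ a b c d → a + b + (c + d) ≡ a + c + (b + d)
  +-+-comm = solve-∀

sumFrom-const : ∀ b x m → sumFrom (λ _ → b) x m ≡ m * b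
sumFrom-const b x zero    = refl
sumFrom-const b x (suc m) = cong (b +_) (sumFrom-const b (suc x) m)

sumFrom-≡-const : ∀ f x m b → (∀ j → j < m → f (x + j) ≡ b) → sumFrom f x m ≡ m * b
sumFrom-≡-const f x m b h = trans (sumFrom-cong f (λ _ → b) x 0 m h) (sumFrom-const b 0 m)

sumFrom-≤-const : ∀ f x m b → (∀ j → j < m → f (x + j) ≤ b) → sumFrom f x m ≤ m * b
sumFrom-≤-const f x m b h = subst (sumFrom f x m ≤_) (sumFrom-const b 0 m) (sumFrom-mono-≤ f (λ _ → b) x 0 m h)

sumFrom-comm : ∀ (h : ℕ → ℕ → ℕ) a x m →
  sumFrom (λ c → sumFrom (h c) 0 a) x m ≡ sumFrom (λ γ → sumFrom (λ c → h c γ) x m) 0 a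
sumFrom-comm h a x zero    = sym (trans (sumFrom-const 0 0 a) (*-zeroʳ a))
sumFrom-comm h a x (suc m) = begin
    sumFrom (h x) 0 a + sumFrom (λ c → sumFrom (h c) 0 a) (suc x) m
  ≡⟨ cong (sumFrom (h x) 0 a +_) (sumFrom-comm h a (suc x) m) ⟩
    sumFrom (h x) 0 a + sumFrom (λ γ → sumFrom (λ c → h c γ) (suc x) m) 0 a
  ≡⟨ sym (sumFrom-distrib (h x) (λ γ → sumFrom (λ c → h c γ) (suc x) m) 0 a) ⟩
    sumFrom (λ γ → h x γ + sumFrom (λ c → h c γ) (suc x) m) 0 a ∎
  where open ≡-Reasoning

sumFrom>0⇒∃ : ∀ f x m → 0 < sumFrom f x m → ∃ λ j → j < m × 0 < f (x + j)
sumFrom>0⇒∃ f x (suc m) p with f x in eq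
... | suc _ = 0 , z<s , subst (0 <_) (trans (sym eq) (cong f (sym (+-identityʳ x)))) z<s
... | zero with sumFrom>0⇒∃ f (suc x) m p
...   | j , j<m , q = suc j , s≤s j<m , subst (λ z → 0 < f z) (sym (+-suc x j)) q

sumFrom≡0⇒ : ∀ f x m → sumFrom f x m ≡ 0 → ∀ j → j < m → f (x + j) ≡ 0
sumFrom≡0⇒ f x (suc m) e zero    _         = trans (cong f (+-identityʳ x)) (m+n≡0⇒m≡0 (f x) e)
sumFrom≡0⇒ f x (suc m) e (suc j) (s≤s j<m) =
  trans (cong f (+-suc x j)) (sumFrom≡0⇒ f (suc x) m (m+n≡0⇒n≡0 (f x) e) j j<m)

sumFrom<length⇒∃ : ∀ f x m → sumFrom f x m < m → ∃ λ j → j < m × f (x + j) ≡ 0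
sumFrom<length⇒∃ f x (suc m) p with f x in eq
... | zero  = 0 , z<s , trans (cong f (+-identityʳ x)) eq
... | suc t with sumFrom<length⇒∃ f (suc x) m (≤-trans (s≤s (m≤n+m _ t)) (s≤s⁻¹ p))
...   | j , j<m , q = suc j , s≤s j<m , trans (cong f (+-suc x j)) q

Periodic : ℕ → (ℕ → ℕ) → Set
Periodic n f = ∀ y → f (y + n) ≡ f y

periodic-* : ∀ n f → Periodic n f → ∀ y q → f (y + q * n) ≡ f y
periodic-* n f p y zero    = cong f (+-identityʳ y)
periodic-* n f p y (suc q) = begin
    f (y + (n + q * n)) ≡⟨ cong f (sym (+-assoc y n (q * n))) ⟩
    f (y + n + q * n)   ≡⟨ periodic-* n f p (y + n) q ⟩
    f (y + n)           ≡⟨ p y ⟩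
    f y                 ∎
  where open ≡-Reasoning

sumFrom-period-rotate : ∀ n f → Periodic n f → ∀ x → sumFrom f x n ≡ sumFrom f 0 n
sumFrom-period-rotate n f p zero    = refl
sumFrom-period-rotate n f p (suc x) = trans step (sumFrom-period-rotate n f p x)
  where
  open ≡-Reasoning
  step : sumFrom f (suc x) n ≡ sumFrom f x n
  step = +-cancelˡ-≡ (f x) _ _ (begin
    sumFrom f x (1 + n)                       ≡⟨ cong (sumFrom f x) (+-comm 1 n) ⟩
    sumFrom f x (n + 1)                       ≡⟨ sumFrom-+ f x n 1 ⟩
    sumFrom f x n + (f (x + n) + 0)           ≡⟨ cong (sumFrom f x n +_) (trans (+-identityʳ _) (p x)) ⟩
    sumFrom f x n + f x                       ≡⟨ +-comm (sumFrom f x n) (f x) ⟩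
    f x + sumFrom f x n                       ∎)

periodic-window-ext : ∀ n .{{_ : NonZero n}} f g → Periodic n f → Periodic n g →
  ∀ z → (∀ j → j < n → f (z + j) ≡ g (z + j)) → ∀ y → f y ≡ g y
periodic-window-ext n f g pf pg z h y = begin
    f y                           ≡⟨ sym (periodic-* n f pf y z) ⟩
    f (y + z * n)                 ≡⟨ cong f (sym z+t≡y+zn) ⟩
    f (z + t)                     ≡⟨ cong (λ w → f (z + w)) (m≡m%n+[m/n]*n t n) ⟩
    f (z + (t % n + t / n * n))   ≡⟨ cong f (sym (+-assoc z _ _)) ⟩
    f (z + t % n + t / n * n)     ≡⟨ periodic-* n f pf _ (t / n) ⟩
    f (z + t % n)                 ≡⟨ h (t % n) (m%n<n t n) ⟩
    g (z + t % n)                 ≡⟨ sym (periodic-* n g pg _ (t / n)) ⟩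
    g (z + t % n + t / n * n)     ≡⟨ cong g (+-assoc z _ _) ⟩
    g (z + (t % n + t / n * n))   ≡⟨ cong (λ w → g (z + w)) (sym (m≡m%n+[m/n]*n t n)) ⟩
    g (z + t)                     ≡⟨ cong g z+t≡y+zn ⟩
    g (y + z * n)                 ≡⟨ periodic-* n g pg y z ⟩
    g y                           ∎
  where
  open ≡-Reasoning
  t = y + z * n ∸ z
  z+t≡y+zn : z + t ≡ y + z * n
  z+t≡y+zn = m+[n∸m]≡n (≤-trans (m≤m*n z n) (m≤n+m (z * n) y))

Binary : (ℕ → ℕ) → Set
Binary f = ∀ y → f y ≤ 1

Sparse : (ℕ → ℕ) → Set
Sparse f = ∀ y → f y + f (suc y) ≤ 1

b2n≤1 : ∀ b → b2n b ≤ 1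
b2n≤1 true  = s≤s z≤n
b2n≤1 false = z≤n

b2n-injective : ∀ {a b} → b2n a ≡ b2n b → a ≡ b
b2n-injective {true}  {true}  _ = refl
b2n-injective {false} {false} _ = refl

b2n-∧-≤ : ∀ a c → b2n (a ∧ c) ≤ b2n a
b2n-∧-≤ true  c = b2n≤1 c
b2n-∧-≤ false c = z≤n

b2n-1≤ᵇ : ∀ {x} → x ≤ 1 → b2n (1 ≤ᵇ x) ≡ x
b2n-1≤ᵇ x≤1 with n≤1⇒n≡0∨n≡1 x≤1
... | inj₁ refl = refl
... | inj₂ refl = refl

binary-disjoint : ∀ a b → a ≤ 1 → b ≤ 1 → (a ≡ 1 → b ≡ 1 → ⊥) → a + b ≤ 1
binary-disjoint a b a≤1 b≤1 h with n≤1⇒n≡0∨n≡1 a≤1 | n≤1⇒n≡0∨n≡1 b≤1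
... | inj₁ refl | _         = b≤1
... | inj₂ refl | inj₁ refl = a≤1
... | inj₂ refl | inj₂ refl = ⊥-elim (h refl refl)

binary-pos⇒≡1 : ∀ {a} → a ≤ 1 → 0 < a → a ≡ 1
binary-pos⇒≡1 (s≤s z≤n) _ = refl

sparse-sumFrom-≤-⌈/2⌉ : ∀ f → Binary f → Sparse f → ∀ x m → sumFrom f x m ≤ ⌈ m /2⌉
sparse-sumFrom-≤-⌈/2⌉ f b s x zero          = z≤n
sparse-sumFrom-≤-⌈/2⌉ f b s x (suc zero)    = subst (_≤ 1) (sym (+-identityʳ (f x))) (b x)
sparse-sumFrom-≤-⌈/2⌉ f b s x (suc (suc m)) = begin
    f x + (f (suc x) + sumFrom f (suc (suc x)) m) ≡⟨ sym (+-assoc (f x) _ _) ⟩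
    f x + f (suc x) + sumFrom f (suc (suc x)) m   ≤⟨ +-mono-≤ (s x) (sparse-sumFrom-≤-⌈/2⌉ f b s (suc (suc x)) m) ⟩
    suc ⌈ m /2⌉                                   ∎
  where open ≤-Reasoning

⌈/2⌉+⌈/2⌉≤1+⌊+/2⌋ : ∀ p q → ⌈ p /2⌉ + ⌈ q /2⌉ ≤ suc ⌊ p + q /2⌋
⌈/2⌉+⌈/2⌉≤1+⌊+/2⌋ zero          q = ⌈n/2⌉≤1+⌊n/2⌋ q
  where
  ⌈n/2⌉≤1+⌊n/2⌋ : ∀ n → ⌈ n /2⌉ ≤ suc ⌊ n /2⌋
  ⌈n/2⌉≤1+⌊n/2⌋ zero          = z≤n
  ⌈n/2⌉≤1+⌊n/2⌋ (suc zero)    = s≤s z≤n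
  ⌈n/2⌉≤1+⌊n/2⌋ (suc (suc n)) = s≤s (⌈n/2⌉≤1+⌊n/2⌋ n)
⌈/2⌉+⌈/2⌉≤1+⌊+/2⌋ (suc zero)    q = ≤-refl
⌈/2⌉+⌈/2⌉≤1+⌊+/2⌋ (suc (suc p)) q = s≤s (⌈/2⌉+⌈/2⌉≤1+⌊+/2⌋ p q)

2*suc : ∀ k → 2 * suc k ≡ suc (suc (2 * k))
2*suc k = cong suc (+-suc k (k + 0))

⌈2*n/2⌉≡n : ∀ n → ⌈ 2 * n /2⌉ ≡ n
⌈2*n/2⌉≡n n = sym (trans (n≡⌈n+n/2⌉ n) (cong (λ m → ⌈ n + m /2⌉) (sym (+-identityʳ n))))

⌊2*n/2⌋≡n : ∀ n → ⌊ 2 * n /2⌋ ≡ n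
⌊2*n/2⌋≡n n = sym (trans (n≡⌊n+n/2⌋ n) (cong (λ m → ⌊ n + m /2⌋) (sym (+-identityʳ n))))

⌊1+2*n/2⌋≡n : ∀ n → ⌊ suc (2 * n) /2⌋ ≡ n
⌊1+2*n/2⌋≡n n = sym (trans (n≡⌈n+n/2⌉ n) (cong (λ m → ⌈ n + m /2⌉) (sym (+-identityʳ n))))

isEven : ℕ → Bool
isEven zero          = true
isEven (suc zero)    = false
isEven (suc (suc y)) = isEven y

alternating : ℕ → ℕ
alternating y = b2n (isEven y)

sparse-window⇒alternating : ∀ f → Binary f → Sparse f → ∀ x j →
  sumFrom f x (suc (2 * j)) ≡ suc j → ∀ y → y ≤ 2 * j → f (x + y) ≡ alternating y
sparse-window⇒alternating f b s x zero e zero _ =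
  trans (cong f (+-identityʳ x)) (trans (sym (+-identityʳ (f x))) e)
sparse-window⇒alternating f b s x (suc j) e = alternates
  where
  open ≤-Reasoning
  tail : ℕ
  tail = sumFrom f (suc (suc x)) (suc (2 * j))
  total : f x + (f (suc x) + tail) ≡ suc (suc j)
  total = trans (cong (λ m → sumFrom f x (suc m)) (sym (2*suc j))) e
  first : f x ≡ 1
  first with n≤1⇒n≡0∨n≡1 (b x)
  ... | inj₂ fx≡1 = fx≡1
  ... | inj₁ fx≡0 = ⊥-elim (1+n≰n (begin
      suc (suc j)                            ≡⟨ sym (subst (λ a → a + (f (suc x) + tail) ≡ suc (suc j)) fx≡0 total) ⟩
      sumFrom f (suc x) (suc (suc (2 * j)))  ≤⟨ sparse-sumFrom-≤-⌈/2⌉ f b s (suc x) _ ⟩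
      suc ⌈ 2 * j /2⌉                        ≡⟨ cong suc (⌈2*n/2⌉≡n j) ⟩
      suc j                                  ∎))
  second : f (suc x) ≡ 0
  second = n≤0⇒n≡0 (+-cancelˡ-≤ 1 _ _ (subst (λ a → a + f (suc x) ≤ 1) first (s x)))
  rest : tail ≡ suc j
  rest = suc-injective (trans (cong₂ (λ a c → a + (c + tail)) (sym first) (sym second)) total)
  alternates : ∀ y → y ≤ 2 * suc j → f (x + y) ≡ alternating y
  alternates zero          _  = trans (cong f (+-identityʳ x)) first
  alternates (suc zero)    _  = trans (cong f (trans (+-suc x 0) (cong suc (+-identityʳ x)))) second
  alternates (suc (suc y)) y≤ = trans (cong f (trans (+-suc x (suc y)) (cong suc (+-suc x y))))
    (sparse-window⇒alternating f b s (suc (suc x)) j rest y (s≤s⁻¹ (s≤s⁻¹ (subst (suc (suc y) ≤_) (2*suc j) y≤))))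

alternating-sparse : Sparse alternating
alternating-sparse zero          = s≤s z≤n
alternating-sparse (suc zero)    = s≤s z≤n
alternating-sparse (suc (suc y)) = alternating-sparse y

sumFrom-alternating : ∀ j → sumFrom alternating 0 (2 * j) ≡ j
sumFrom-alternating zero    = refl
sumFrom-alternating (suc j) = trans (cong (sumFrom alternating 0) (2*suc j))
  (cong suc (trans (sumFrom-cong alternating alternating 2 0 (2 * j) (λ _ _ → refl)) (sumFrom-alternating j)))

isEven-even : ∀ j → isEven (2 * j) ≡ true
isEven-even zero    = refl
isEven-even (suc j) = trans (cong isEven (2*suc j)) (isEven-even j)

isEven-odd : ∀ j → isEven (suc (2 * j)) ≡ false
isEven-odd zero    = refl
isEven-odd (suc j) = trans (cong (isEven ∘ suc) (2*suc j)) (isEven-odd j)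

bitAt : ∀ {m} → Vec Bool m → ℕ → ℕ
bitAt []      _       = 0
bitAt (b ∷ U) zero    = b2n b
bitAt (b ∷ U) (suc y) = bitAt U y

bitAt-binary : ∀ {m} (U : Vec Bool m) → Binary (bitAt U)
bitAt-binary []      y       = z≤n
bitAt-binary (b ∷ U) zero    = b2n≤1 b
bitAt-binary (b ∷ U) (suc y) = bitAt-binary U y

bitAt-toℕ : ∀ {m} (U : Vec Bool m) (i : Fin m) → bitAt U (toℕ i) ≡ b2n (lookup U i)
bitAt-toℕ (b ∷ U) F.zero    = refl
bitAt-toℕ (b ∷ U) (F.suc i) = bitAt-toℕ U i

∣∣≡sumFrom-bitAt : ∀ {m} (U : Vec Bool m) → ∣ U ∣ ≡ sumFrom (bitAt U) 0 m
∣∣≡sumFrom-bitAt []          = refl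
∣∣≡sumFrom-bitAt {suc m} (true ∷ U)  =
  cong suc (trans (∣∣≡sumFrom-bitAt U) (sumFrom-cong (bitAt U) (bitAt (true ∷ U)) 0 1 m (λ _ _ → refl)))
∣∣≡sumFrom-bitAt {suc m} (false ∷ U) =
  trans (∣∣≡sumFrom-bitAt U) (sumFrom-cong (bitAt U) (bitAt (false ∷ U)) 0 1 m (λ _ _ → refl))

bitAt≡1⇒∈ : ∀ {m} (U : Vec Bool m) {y} (y<m : y < m) → bitAt U y ≡ 1 → fromℕ< y<m ∈ U
bitAt≡1⇒∈ U {y} y<m e = VP.lookup⇒[]= (fromℕ< y<m) U
  (b2n-injective (trans (sym (bitAt-toℕ U (fromℕ< y<m))) (trans (cong (bitAt U) (FP.toℕ-fromℕ< y<m)) e)))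

subsetℕ : ∀ m → (ℕ → Bool) → Subset m
subsetℕ m h = tabulate (h ∘ toℕ)

bitAt-subsetℕ : ∀ m h y → y < m → bitAt (subsetℕ m h) y ≡ b2n (h y)
bitAt-subsetℕ m h y y<m = begin
    bitAt (subsetℕ m h) y                ≡⟨ cong (bitAt (subsetℕ m h)) (sym (FP.toℕ-fromℕ< y<m)) ⟩
    bitAt (subsetℕ m h) (toℕ i)          ≡⟨ bitAt-toℕ (subsetℕ m h) i ⟩
    b2n (lookup (subsetℕ m h) i)         ≡⟨ cong b2n (VP.lookup∘tabulate (h ∘ toℕ) i) ⟩
    b2n (h (toℕ i))                      ≡⟨ cong (b2n ∘ h) (FP.toℕ-fromℕ< y<m) ⟩
    b2n (h y)                            ∎
  where
  open ≡-Reasoning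
  i = fromℕ< y<m

-- Rotate to a window starting at some c with f c = 1: the positions at distance k … n − k from c
-- are empty, and the remaining 2(k − 1) positions form k − 1 pairs at distance n − k.
katona : ∀ n k → 1 ≤ k → k + k ≤ n → (f : ℕ → ℕ) → Binary f → Periodic n f →
  (∀ c s → k ≤ s → s + k ≤ n → f c + f (c + s) ≤ 1) → sumFrom f 0 n ≤ k
katona n (suc k-1) _ k+k≤n f binary periodic apart with sumFrom f 0 n in total
... | zero  = z≤n
... | suc _ with sumFrom>0⇒∃ f 0 n (subst (0 <_) (sym total) z<s)
...   | c , _ , fc>0 = subst (_≤ k) (trans (sumFrom-period-rotate n f periodic c) total) around-c
  where
  open ≤-Reasoning
  k = suc k-1
  t = n ∸ (k + k)
  n-k = k-1 + suc t
  k+k+t≡n : k + k + t ≡ n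
  k+k+t≡n = m+[n∸m]≡n k+k≤n
  n-k+k≡n : n-k + k ≡ n
  n-k+k≡n = trans (reassoc k-1 t) k+k+t≡n
    where
    reassoc : ∀ a t → a + suc t + suc a ≡ suc a + suc a + t
    reassoc = solve-∀
  fc≡1 : f c ≡ 1
  fc≡1 = binary-pos⇒≡1 (binary c) fc>0
  far-from-c : ∀ s → k ≤ s → s + k ≤ n → f (c + s) ≡ 0
  far-from-c s k≤s s+k≤n = n≤0⇒n≡0 (+-cancelˡ-≤ 1 _ _ (subst (λ a → a + f (c + s) ≤ 1) fc≡1 (apart c s k≤s s+k≤n)))
  gap : sumFrom f (suc c + k-1) (suc t) ≡ 0
  gap = trans (sumFrom-≡-const f _ (suc t) 0 λ j j≤t →
      trans (cong f (reassoc c k-1 j)) (far-from-c (k + j) (m≤m+n k j) (within j (s≤s⁻¹ j≤t))))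
    (*-zeroʳ (suc t))
    where
    reassoc : ∀ c a j → suc c + a + j ≡ c + (suc a + j)
    reassoc = solve-∀
    within : ∀ j → j ≤ t → k + j + k ≤ n
    within j j≤t = subst₂ _≤_ (swap k j) k+k+t≡n (+-monoʳ-≤ (k + k) j≤t)
      where
      swap : ∀ k j → k + k + j ≡ k + j + k
      swap = solve-∀
  pairs : sumFrom f (suc c) k-1 + sumFrom f (suc c + n-k) k-1 ≤ k-1
  pairs = begin
      sumFrom f (suc c) k-1 + sumFrom f (suc c + n-k) k-1
        ≡⟨ cong (sumFrom f (suc c) k-1 +_) (sumFrom-cong f (λ y → f (y + n-k)) (suc c + n-k) (suc c) k-1 (λ j _ → cong f (swap (suc c) n-k j))) ⟩
      sumFrom f (suc c) k-1 + sumFrom (λ y → f (y + n-k)) (suc c) k-1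
        ≡⟨ sym (sumFrom-distrib f (λ y → f (y + n-k)) (suc c) k-1) ⟩
      sumFrom (λ y → f y + f (y + n-k)) (suc c) k-1
        ≤⟨ sumFrom-≤-const _ (suc c) k-1 1 (λ j _ →
             apart (suc c + j) n-k (subst (k ≤_) (sym (+-suc k-1 t)) (s≤s (m≤m+n k-1 t))) (≤-reflexive n-k+k≡n)) ⟩
      k-1 * 1
        ≡⟨ *-identityʳ k-1 ⟩
      k-1 ∎
    where
    swap : ∀ a b c → a + b + c ≡ a + c + b
    swap = solve-∀
  around-c : sumFrom f c n ≤ k
  around-c = begin
      sumFrom f c n
        ≡⟨ cong (sumFrom f c) (sym (trans (split k-1 t) k+k+t≡n)) ⟩
      f c + sumFrom f (suc c) (k-1 + (suc t + k-1))
        ≡⟨ cong (f c +_) (sumFrom-+ f (suc c) k-1 (suc t + k-1)) ⟩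
      f c + (sumFrom f (suc c) k-1 + sumFrom f (suc c + k-1) (suc t + k-1))
        ≡⟨ cong (λ z → f c + (sumFrom f (suc c) k-1 + z)) (sumFrom-+ f (suc c + k-1) (suc t) k-1) ⟩
      f c + (sumFrom f (suc c) k-1 + (sumFrom f (suc c + k-1) (suc t) + sumFrom f (suc c + k-1 + suc t) k-1))
        ≡⟨ cong₂ (λ a b → f c + (sumFrom f (suc c) k-1 + (a + sumFrom f b k-1))) gap (+-assoc (suc c) k-1 (suc t)) ⟩
      f c + (sumFrom f (suc c) k-1 + sumFrom f (suc c + n-k) k-1)
        ≤⟨ +-mono-≤ (binary c) pairs ⟩
      k ∎
    where
    split : ∀ a t → suc (a + (suc t + a)) ≡ suc a + suc a + t
    split = solve-∀

cross-<-≤ : ∀ a b n k a' b' → 1 ≤ b' → a * k < n * b → n * b' ≤ a' * k → a * b' < a' * b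
cross-<-≤ a b n k a' b'@(suc _) _ ak<nb nb'≤a'k = *-cancelʳ-< k (a * b') (a' * b) (begin-strict
    a * b' * k   ≡⟨ swap a b' k ⟩
    a * k * b'   <⟨ *-monoˡ-< b' ak<nb ⟩
    n * b * b'   ≡⟨ swap n b b' ⟩
    n * b' * b   ≤⟨ *-monoˡ-≤ b nb'≤a'k ⟩
    a' * k * b   ≡⟨ swap a' k b ⟩
    a' * b * k   ∎)
  where
  open ≤-Reasoning
  swap : ∀ x y z → x * y * z ≡ x * z * y
  swap = solve-∀

toℕ-csuc : ∀ {m} (i : Fin (suc m)) → toℕ (csuc i) ≡ suc (toℕ i) % suc m
toℕ-csuc {m} i with suc (toℕ i) <? suc m
... | yes p = trans (FP.toℕ-fromℕ< p) (sym (m<n⇒m%n≡m p))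
... | no ¬p = sym (trans (cong (_% suc m) (≤-antisym (FP.toℕ<n i) (≮⇒≥ ¬p))) (n%n≡0 (suc m)))

module Cyclic (n-1 : ℕ) where

  n : ℕ
  n = suc n-1

  ind : Subset n → ℕ → ℕ
  ind U y = bitAt U (y % n)

  ind-binary : ∀ U → Binary (ind U)
  ind-binary U y = bitAt-binary U (y % n)

  ind-periodic : ∀ U → Periodic n (ind U)
  ind-periodic U y = cong (bitAt U) ([m+n]%n≡m%n y n)

  ind-% : ∀ U y → ind U (y % n) ≡ ind U y
  ind-% U y = cong (bitAt U) (m%n%n≡m%n y n)

  ind-%+ : ∀ U y j → ind U (y % n + j) ≡ ind U (y + j)
  ind-%+ U y j = cong (bitAt U) (begin
      (y % n + j) % n          ≡⟨ %-distribˡ-+ (y % n) j n ⟩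
      (y % n % n + j % n) % n  ≡⟨ cong (λ z → (z + j % n) % n) (m%n%n≡m%n y n) ⟩
      (y % n + j % n) % n      ≡⟨ sym (%-distribˡ-+ y j n) ⟩
      (y + j) % n              ∎)
    where open ≡-Reasoning

  ind-< : ∀ U y → y < n → ind U y ≡ bitAt U y
  ind-< U y y<n = cong (bitAt U) (m<n⇒m%n≡m y<n)

  ind-toℕ : ∀ U (i : Fin n) → ind U (toℕ i) ≡ b2n (lookup U i)
  ind-toℕ U i = trans (ind-< U (toℕ i) (FP.toℕ<n i)) (bitAt-toℕ U i)

  ind-csuc : ∀ U (i : Fin n) → ind U (suc (toℕ i)) ≡ b2n (lookup U (csuc i))
  ind-csuc U i = trans (sym (ind-% U (suc (toℕ i)))) (trans (cong (ind U) (sym (toℕ-csuc i))) (ind-toℕ U (csuc i)))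

  index : ℕ → Fin n
  index y = fromℕ< (m%n<n y n)

  ind-index : ∀ U y → b2n (lookup U (index y)) ≡ ind U y
  ind-index U y = trans (sym (ind-toℕ U (index y))) (trans (cong (ind U) (FP.toℕ-fromℕ< (m%n<n y n))) (ind-% U y))

  ind-suc-% : ∀ U y → ind U (suc (y % n)) ≡ ind U (suc y)
  ind-suc-% U y = trans (cong (ind U) (+-comm 1 (y % n))) (trans (ind-%+ U y 1) (cong (ind U) (+-comm y 1)))

  ind-csuc-index : ∀ U y → b2n (lookup U (csuc (index y))) ≡ ind U (suc y)
  ind-csuc-index U y = trans (sym (ind-csuc U (index y)))
    (trans (cong (λ z → ind U (suc z)) (FP.toℕ-fromℕ< (m%n<n y n))) (ind-suc-% U y))

  ∈⇒ind≡1 : ∀ U (i : Fin n) → i ∈ U → ind U (toℕ i) ≡ 1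
  ∈⇒ind≡1 U i i∈U = trans (ind-toℕ U i) (cong b2n (VP.[]=⇒lookup i∈U))

  ind≡1⇒∈ : ∀ U y → ind U y ≡ 1 → index y ∈ U
  ind≡1⇒∈ U y e = VP.lookup⇒[]= (index y) U (b2n-injective (trans (ind-index U y) e))

  disjoint⇒¬both : ∀ S T → Disjoint S T → ∀ y → ind S y ≡ 1 → ind T y ≡ 1 → ⊥
  disjoint⇒¬both S T d y p q = d (index y) (ind≡1⇒∈ S y p) (ind≡1⇒∈ T y q)

  ∣∣≡period-sum : ∀ U → ∣ U ∣ ≡ sumFrom (ind U) 0 n
  ∣∣≡period-sum U = trans (∣∣≡sumFrom-bitAt U) (sumFrom-cong _ _ 0 0 n (λ j j<n → sym (ind-< U j j<n)))

  arcCount≡sumFrom : ∀ U (i : Fin n) m → arcCount U i m ≡ sumFrom (ind U) (toℕ i) m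
  arcCount≡sumFrom U i zero    = refl
  arcCount≡sumFrom U i (suc m) = cong₂ _+_ (sym (ind-toℕ U i)) (begin
      arcCount U (csuc i) m                ≡⟨ arcCount≡sumFrom U (csuc i) m ⟩
      sumFrom (ind U) (toℕ (csuc i)) m     ≡⟨ cong (λ z → sumFrom (ind U) z m) (toℕ-csuc i) ⟩
      sumFrom (ind U) (suc (toℕ i) % n) m  ≡⟨ sumFrom-cong _ _ _ _ m (λ j _ → ind-%+ U (suc (toℕ i)) j) ⟩
      sumFrom (ind U) (suc (toℕ i)) m      ∎)
    where open ≡-Reasoning

  ≡-from-window : ∀ U V z → (∀ j → j < n → ind U (z + j) ≡ ind V (z + j)) → U ≡ V
  ≡-from-window U V z h = begin
      U                       ≡⟨ sym (VP.tabulate∘lookup U) ⟩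
      tabulate (lookup U)     ≡⟨ VP.tabulate-cong lookups ⟩
      tabulate (lookup V)     ≡⟨ VP.tabulate∘lookup V ⟩
      V                       ∎
    where
    open ≡-Reasoning
    agree : ∀ y → ind U y ≡ ind V y
    agree = periodic-window-ext n (ind U) (ind V) (ind-periodic U) (ind-periodic V) z h
    lookups : ∀ i → lookup U i ≡ lookup V i
    lookups i = b2n-injective (trans (sym (ind-toℕ U i)) (trans (agree (toℕ i)) (ind-toℕ V i)))

  separated⇒sparse : ∀ U → (∀ i → i ∈ U → csuc i ∈ U → ⊥) → Sparse (ind U)
  separated⇒sparse U sep y = binary-disjoint _ _ (ind-binary U y) (ind-binary U (suc y)) λ p q →
    sep (index y) (ind≡1⇒∈ U y p)
        (VP.lookup⇒[]= (csuc (index y)) U (b2n-injective (trans (ind-csuc-index U y) q)))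

  sparse⇒separated : ∀ U → Sparse (ind U) → ∀ i → i ∈ U → csuc i ∈ U → ⊥
  sparse⇒separated U s i i∈U si∈U = 1+n≰n (subst₂ (λ a b → a + b ≤ 1) (∈⇒ind≡1 U i i∈U) next (s (toℕ i)))
    where
    next : ind U (suc (toℕ i)) ≡ 1
    next = trans (ind-csuc U i) (cong b2n (VP.[]=⇒lookup si∈U))

  sparse-on-period⇒sparse : ∀ U → (∀ z → z < n → ind U z + ind U (suc z) ≤ 1) → Sparse (ind U)
  sparse-on-period⇒sparse U h y = subst₂ (λ a b → a + b ≤ 1) (ind-% U y) (ind-suc-% U y) (h (y % n) (m%n<n y n))

  module _ {k : ℕ} (U : Subset n) (v : SGVertex n k U) where

    vertex-sparse : Sparse (ind U)
    vertex-sparse = separated⇒sparse U (proj₂ v)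

    vertex-window-sum : ∀ x → sumFrom (ind U) x n ≡ k
    vertex-window-sum x = trans (sumFrom-period-rotate n (ind U) (ind-periodic U) x) (trans (sym (∣∣≡period-sum U)) (proj₁ v))

    arc+coarc : ∀ x m → m ≤ n → sumFrom (ind U) x m + sumFrom (ind U) (x + m) (n ∸ m) ≡ k
    arc+coarc x m m≤n = begin
        sumFrom (ind U) x m + sumFrom (ind U) (x + m) (n ∸ m) ≡⟨ sym (sumFrom-+ (ind U) x m (n ∸ m)) ⟩
        sumFrom (ind U) x (m + (n ∸ m))                         ≡⟨ cong (sumFrom (ind U) x) (m+[n∸m]≡n m≤n) ⟩
        sumFrom (ind U) x n                                     ≡⟨ vertex-window-sum x ⟩
        k                                                       ∎
      where open ≡-Reasoning

  gap-determines-vertex : ∀ j d z U V → SGVertex n (suc j) U → SGVertex n (suc j) V → d + suc (2 * j) ≡ n →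
    sumFrom (ind U) z d ≡ 0 → sumFrom (ind V) z d ≡ 0 → U ≡ V
  gap-determines-vertex j d z U V U-vertex V-vertex d+2j+1≡n U-gap V-gap = ≡-from-window U V z agree
    where
    alternates : ∀ W → SGVertex n (suc j) W → sumFrom (ind W) z d ≡ 0 →
      ∀ y → y ≤ 2 * j → ind W (z + d + y) ≡ alternating y
    alternates W W-vertex W-gap = sparse-window⇒alternating (ind W) (ind-binary W) (vertex-sparse W W-vertex) (z + d) j
      (trans (cong (_+ sumFrom (ind W) (z + d) (suc (2 * j))) (sym W-gap))
      (trans (sym (sumFrom-+ (ind W) z d (suc (2 * j))))
      (trans (cong (sumFrom (ind W) z) d+2j+1≡n) (vertex-window-sum W W-vertex z))))
    agree : ∀ y → y < n → ind U (z + y) ≡ ind V (z + y)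
    agree y y<n with y <? d
    ... | yes y<d = trans (sumFrom≡0⇒ (ind U) z d U-gap y y<d) (sym (sumFrom≡0⇒ (ind V) z d V-gap y y<d))
    ... | no y≮d = begin
        ind U (z + y)             ≡⟨ cong (ind U) z+y≡z+d+i ⟩
        ind U (z + d + i)         ≡⟨ alternates U U-vertex U-gap i i≤2j ⟩
        alternating i             ≡⟨ sym (alternates V V-vertex V-gap i i≤2j) ⟩
        ind V (z + d + i)         ≡⟨ cong (ind V) (sym z+y≡z+d+i) ⟩
        ind V (z + y)             ∎
      where
      open ≡-Reasoning
      i = y ∸ d
      i≤2j : i ≤ 2 * j
      i≤2j = s≤s⁻¹ (m<n+o⇒m∸n<o y d (subst (y <_) (sym d+2j+1≡n) y<n))
      z+y≡z+d+i : z + y ≡ z + d + i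
      z+y≡z+d+i = trans (cong (z +_) (sym (m+[n∸m]≡n (≮⇒≥ y≮d)))) (sym (+-assoc z d i))

  balanced⇒well-spread : ∀ U → (∀ x y m → m ≤ n → sumFrom (ind U) x m ≤ suc (sumFrom (ind U) y m)) →
    WellSpread n U
  balanced⇒well-spread U h i j m _ m≤n-1 =
    subst₂ (λ a b → a ≤ suc b) (sym (arcCount≡sumFrom U i m)) (sym (arcCount≡sumFrom U j m))
      (h (toℕ i) (toℕ j) m (≤-trans m≤n-1 (m∸n≤m n 1)))

  well-spread⇒balanced : ∀ U → WellSpread n U → ∀ x y m → 1 ≤ m → m ≤ n ∸ 1 →
    sumFrom (ind U) x m ≤ suc (sumFrom (ind U) y m)
  well-spread⇒balanced U ws x y m 1≤m m≤n-1 =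
    subst₂ (λ a b → a ≤ suc b) (arc x) (arc y) (ws (index x) (index y) m 1≤m m≤n-1)
    where
    arc : ∀ x → arcCount U (index x) m ≡ sumFrom (ind U) x m
    arc x = trans (arcCount≡sumFrom U (index x) m)
      (trans (cong (λ z → sumFrom (ind U) z m) (FP.toℕ-fromℕ< (m%n<n x n)))
             (sumFrom-cong _ _ _ _ m (λ j _ → ind-%+ U x j)))

  singleton-well-spread : ∀ U → SGVertex n 1 U → WellSpread n U
  singleton-well-spread U v = balanced⇒well-spread U λ x y m m≤n →
    ≤-trans (subst (sumFrom (ind U) x m ≤_) (arc+coarc U v x m m≤n) (m≤m+n _ _)) (s≤s z≤n)

  half-well-spread : ∀ {k} U → ⌊ n /2⌋ ≡ k → SGVertex n k U → WellSpread n U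
  half-well-spread U ⌊n/2⌋≡k v = balanced⇒well-spread U λ x y m m≤n →
    let f = ind U ; sparse = sparse-sumFrom-≤-⌈/2⌉ f (ind-binary U) (vertex-sparse U v) in
    +-cancelʳ-≤ (sumFrom f (y + m) (n ∸ m)) _ _ (begin
      sumFrom f x m + sumFrom f (y + m) (n ∸ m) ≤⟨ +-mono-≤ (sparse x m) (sparse (y + m) (n ∸ m)) ⟩
      ⌈ m /2⌉ + ⌈ n ∸ m /2⌉                      ≤⟨ ⌈/2⌉+⌈/2⌉≤1+⌊+/2⌋ m (n ∸ m) ⟩
      suc ⌊ m + (n ∸ m) /2⌋                      ≡⟨ cong (λ z → suc ⌊ z /2⌋) (m+[n∸m]≡n m≤n) ⟩
      suc ⌊ n /2⌋                                ≡⟨ cong suc (trans ⌊n/2⌋≡k (sym (arc+coarc U v y m m≤n))) ⟩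
      suc (sumFrom f y m) + sumFrom f (y + m) (n ∸ m) ∎)
    where open ≤-Reasoning

module Circular (n-1 k : ℕ) (2k≤n : 2 * k ≤ suc n-1) where
  open Cyclic n-1

  k+k≤n : k + k ≤ n
  k+k≤n = subst (_≤ n) (cong (k +_) (+-identityʳ k)) 2k≤n

  k≤n : k ≤ n
  k≤n = ≤-trans (m≤m+n k k) k+k≤n

  -- circular c = {y : (c + k y) mod n ≥ n − k}: y is a member iff the walk c, c + k, c + 2k, …
  -- (taken mod n) wraps around between steps y and y + 1.
  pos : ℕ → ℕ → ℕ
  pos c y = (c + k * y) % n

  member? : ℕ → ℕ → Bool
  member? c y = n ≤ᵇ pos c y + k

  mark : ℕ → ℕ → ℕ
  mark c y = b2n (member? c y)

  circular : ℕ → Subset n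
  circular c = subsetℕ n (member? c)

  pos<n : ∀ c y → pos c y < n
  pos<n c y = m%n<n (c + k * y) n

  member⇒ : ∀ c y → member? c y ≡ true → n ≤ pos c y + k
  member⇒ c y e = ≤ᵇ⇒≤ n (pos c y + k) (subst T (sym e) tt)

  non-member⇒ : ∀ c y → member? c y ≡ false → pos c y + k < n
  non-member⇒ c y e = ≰⇒> (λ n≤ → subst T e (≤⇒≤ᵇ n≤))

  %+-wrap : ∀ a b → a < n → b ≤ n → n ≤ a + b → (a + b) % n + n ≡ a + b
  %+-wrap a b a<n b≤n n≤a+b = begin
      (a + b) % n + n       ≡⟨ cong (_+ n) (sym (m≤n⇒[n∸m]%m≡n%m n≤a+b)) ⟩
      (a + b ∸ n) % n + n   ≡⟨ cong (_+ n) (m<n⇒m%n≡m a+b∸n<n) ⟩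
      a + b ∸ n + n         ≡⟨ m∸n+n≡m n≤a+b ⟩
      a + b                 ∎
    where
    open ≡-Reasoning
    a+b∸n<n : a + b ∸ n < n
    a+b∸n<n = +-cancelʳ-< n _ _ (subst (_< n + n) (sym (m∸n+n≡m n≤a+b)) (+-mono-<-≤ a<n b≤n))

  pos-+ : ∀ c s y → pos (c + s) y ≡ (pos c y + s) % n
  pos-+ c s y = trans (cong (_% n) (+-comm-middle c s (k * y))) (mod-+ (c + k * y) s)
    where
    +-comm-middle : ∀ a b d → a + b + d ≡ a + d + b
    +-comm-middle = solve-∀
    mod-+ : ∀ a b → (a + b) % n ≡ (a % n + b) % n
    mod-+ a b = trans (%-distribˡ-+ a b n)
      (sym (trans (%-distribˡ-+ (a % n) b n) (cong (λ z → (z + b % n) % n) (m%n%n≡m%n a n))))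

  pos-suc : ∀ c y → pos c (suc y) ≡ pos (c + k) y
  pos-suc c y = cong (_% n) (trans (cong (c +_) (*-suc k y)) (sym (+-assoc c k (k * y))))

  carry : ∀ c y → n * mark c y + pos c (suc y) ≡ pos c y + k
  carry c y rewrite pos-suc c y | pos-+ c k y with member? c y in e
  ... | true  = trans (cong (_+ (pos c y + k) % n) (*-identityʳ n))
                      (trans (+-comm n _) (%+-wrap (pos c y) k (pos<n c y) k≤n (member⇒ c y e)))
  ... | false = trans (cong (_+ (pos c y + k) % n) (*-zeroʳ n)) (m<n⇒m%n≡m (non-member⇒ c y e))

  marks-invariant : ∀ c m → n * sumFrom (mark c) 0 m + pos c m ≡ pos c 0 + k * m
  marks-invariant c zero    = rearrange₀ n (pos c 0) k
    where
    rearrange₀ : ∀ n a k → n * 0 + a ≡ a + k * 0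
    rearrange₀ = solve-∀
  marks-invariant c (suc m) = begin
      n * sumFrom (mark c) 0 (suc m) + pos c (suc m)              ≡⟨ cong (λ z → n * sumFrom (mark c) 0 z + pos c (suc m)) (+-comm 1 m) ⟩
      n * sumFrom (mark c) 0 (m + 1) + pos c (suc m)              ≡⟨ cong (λ z → n * z + pos c (suc m)) (sumFrom-+ (mark c) 0 m 1) ⟩
      n * (sumFrom (mark c) 0 m + (mark c m + 0)) + pos c (suc m) ≡⟨ rearrange₁ n (sumFrom (mark c) 0 m) (mark c m) (pos c (suc m)) ⟩
      n * sumFrom (mark c) 0 m + (n * mark c m + pos c (suc m))   ≡⟨ cong (n * sumFrom (mark c) 0 m +_) (carry c m) ⟩
      n * sumFrom (mark c) 0 m + (pos c m + k)                    ≡⟨ sym (+-assoc _ (pos c m) k) ⟩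
      n * sumFrom (mark c) 0 m + pos c m + k                      ≡⟨ cong (_+ k) (marks-invariant c m) ⟩
      pos c 0 + k * m + k                                         ≡⟨ rearrange₂ (pos c 0) k m ⟩
      pos c 0 + k * suc m                                         ∎
    where
    open ≡-Reasoning
    rearrange₁ : ∀ n w x y → n * (w + (x + 0)) + y ≡ n * w + (n * x + y)
    rearrange₁ = solve-∀
    rearrange₂ : ∀ a k m → a + k * m + k ≡ a + k * suc m
    rearrange₂ = solve-∀

  -- In n steps the walk advances by k n, so it wraps around exactly k times.
  marks-period-sum : ∀ c → sumFrom (mark c) 0 n ≡ k
  marks-period-sum c = *-cancelˡ-≡ _ _ n (+-cancelʳ-≡ (pos c 0) _ _ (begin
      n * sumFrom (mark c) 0 n + pos c 0  ≡⟨ cong (n * sumFrom (mark c) 0 n +_) (sym pos-n) ⟩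
      n * sumFrom (mark c) 0 n + pos c n  ≡⟨ marks-invariant c n ⟩
      pos c 0 + k * n                     ≡⟨ +-comm (pos c 0) _ ⟩
      k * n + pos c 0                     ≡⟨ cong (_+ pos c 0) (*-comm k n) ⟩
      n * k + pos c 0                     ∎))
    where
    open ≡-Reasoning
    pos-n : pos c n ≡ pos c 0
    pos-n = trans ([m+kn]%n≡m%n c k n) (cong (_% n) (sym (trans (cong (c +_) (*-zeroʳ k)) (+-identityʳ c))))

  members-apart : ∀ c s y → k ≤ s → s + k ≤ n → member? c y ≡ true → member? (c + s) y ≡ true → ⊥
  members-apart c s y k≤s s+k≤n e₁ e₂ = <⇒≱ (pos<n c y) (+-cancelʳ-≤ n _ _ (begin
      n + n                       ≤⟨ +-monoʳ-≤ n (member⇒ (c + s) y e₂) ⟩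
      n + (pos (c + s) y + k)     ≡⟨ rearrange n (pos (c + s) y) k ⟩
      pos (c + s) y + n + k       ≡⟨ cong (_+ k) wrapped ⟩
      a + s + k                   ≡⟨ +-assoc a s k ⟩
      a + (s + k)                 ≤⟨ +-monoʳ-≤ a s+k≤n ⟩
      a + n                       ∎))
    where
    open ≤-Reasoning
    a = pos c y
    rearrange : ∀ n b k → n + (b + k) ≡ b + n + k
    rearrange = solve-∀
    wrapped : pos (c + s) y + n ≡ a + s
    wrapped = trans (cong (_+ n) (pos-+ c s y))
      (%+-wrap a s (pos<n c y) (≤-trans (m≤m+n s k) s+k≤n) (≤-trans (member⇒ c y e₁) (+-monoʳ-≤ a k≤s)))

  wrap : ∀ c y → member? c y ≡ true → pos c (suc y) + n ≡ pos c y + k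
  wrap c y e = trans (+-comm _ n) (trans (cong (_+ pos c (suc y)) (sym (*-identityʳ n)))
    (subst (λ b → n * b2n b + pos c (suc y) ≡ pos c y + k) e (carry c y)))

  no-wrap : ∀ c y → member? c y ≡ false → pos c (suc y) ≡ pos c y + k
  no-wrap c y e = trans (cong (_+ pos c (suc y)) (sym (*-zeroʳ n)))
    (subst (λ b → n * b2n b + pos c (suc y) ≡ pos c y + k) e (carry c y))

  pos-after-wrap<k : ∀ c y → member? c y ≡ true → pos c (suc y) < k
  pos-after-wrap<k c y e = +-cancelʳ-< n _ _ (subst (_< k + n) (sym (wrap c y e))
    (subst (pos c y + k <_) (+-comm n k) (+-monoˡ-< k (pos<n c y))))

  pos-two-after-wrap : ∀ c y → member? c y ≡ true → pos c (suc (suc y)) ≡ pos c (suc y) + k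
  pos-two-after-wrap c y e = trans (pos-suc c (suc y)) (trans (pos-+ c k (suc y))
    (m<n⇒m%n≡m (<-≤-trans (+-monoˡ-< k (pos-after-wrap<k c y e)) k+k≤n)))

  members-two-apart⇒n<3k : ∀ c y → member? c y ≡ true → member? c (suc (suc y)) ≡ true → n < k + k + k
  members-two-apart⇒n<3k c y e₀ e₂ = +-cancelˡ-< n _ _ (begin-strict
      n + n                               ≤⟨ +-monoʳ-≤ n (member⇒ c (suc (suc y)) e₂) ⟩
      n + (pos c (suc (suc y)) + k)       ≡⟨ cong (λ z → n + (z + k)) (pos-two-after-wrap c y e₀) ⟩
      n + (pos c (suc y) + k + k)         ≡⟨ rearrange₁ n (pos c (suc y)) k ⟩
      pos c (suc y) + n + (k + k)         ≡⟨ cong (_+ (k + k)) (wrap c y e₀) ⟩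
      pos c y + k + (k + k)               ≡⟨ rearrange₂ (pos c y) k ⟩
      pos c y + (k + k + k)               <⟨ +-monoˡ-< (k + k + k) (pos<n c y) ⟩
      n + (k + k + k)                     ∎)
    where
    open ≤-Reasoning
    rearrange₁ : ∀ n a k → n + (a + k + k) ≡ a + n + (k + k)
    rearrange₁ = solve-∀
    rearrange₂ : ∀ a k → a + k + (k + k) ≡ a + (k + k + k)
    rearrange₂ = solve-∀

  isolated-member⇒3k<n : ∀ c y → member? c y ≡ true → member? c (suc (suc y)) ≡ false →
    member? c (suc (suc (suc y))) ≡ false → k + k + k < n
  isolated-member⇒3k<n c y e₀ e₂ e₃ = begin-strict
      k + k + k                            ≤⟨ m≤n+m _ (pos c (suc y)) ⟩
      pos c (suc y) + (k + k + k)          ≡⟨ rearrange (pos c (suc y)) k ⟩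
      pos c (suc y) + k + k + k            ≡⟨ cong (λ z → z + k + k) (sym (pos-two-after-wrap c y e₀)) ⟩
      pos c (suc (suc y)) + k + k          ≡⟨ cong (_+ k) (sym (no-wrap c (suc (suc y)) e₂)) ⟩
      pos c (suc (suc (suc y))) + k        <⟨ non-member⇒ c (suc (suc (suc y))) e₃ ⟩
      n                                    ∎
    where
    open ≤-Reasoning
    rearrange : ∀ a k → a + (k + k + k) ≡ a + k + k + k
    rearrange = solve-∀

  member?-% : ∀ c y → member? c (y % n) ≡ member? c y
  member?-% c y = cong (λ z → n ≤ᵇ z + k) (trans (sym ([m+kn]%n≡m%n (c + k * (y % n)) (k * (y / n)) n)) (cong (_% n) regroup))
    where
    regroup : c + k * (y % n) + k * (y / n) * n ≡ c + k * y
    regroup = trans (distrib c k (y % n) (y / n) n) (cong (λ z → c + k * z) (sym (m≡m%n+[m/n]*n y n)))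
      where
      distrib : ∀ c k a b n → c + k * a + k * b * n ≡ c + k * (a + b * n)
      distrib = solve-∀

  ind-circular : ∀ c y → ind (circular c) y ≡ mark c y
  ind-circular c y = trans (bitAt-subsetℕ n (member? c) (y % n) (m%n<n y n)) (cong b2n (member?-% c y))

  circular-vertex : ∀ c → SGVertex n k (circular c)
  circular-vertex c = size , sparse⇒separated (circular c) sparse
    where
    size : ∣ circular c ∣ ≡ k
    size = trans (∣∣≡period-sum (circular c)) (trans (sumFrom-cong _ _ 0 0 n (λ j _ → ind-circular c j)) (marks-period-sum c))
    sparse : Sparse (ind (circular c))
    sparse y = subst₂ (λ a b → a + b ≤ 1) (sym (ind-circular c y)) (sym (ind-circular c (suc y)))
      (binary-disjoint (mark c y) (mark c (suc y)) (b2n≤1 _) (b2n≤1 _) λ p q →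
        members-apart c k y ≤-refl k+k≤n (b2n-injective p)
          (trans (cong (n ≤ᵇ_) (cong (_+ k) (sym (pos-suc c y)))) (b2n-injective q)))

  circular-disjoint : ∀ c s → k ≤ s → s + k ≤ n → Disjoint (circular c) (circular (c + s))
  circular-disjoint c s k≤s s+k≤n x x∈Sc x∈Sc+s =
    members-apart c s (toℕ x) k≤s s+k≤n (member {c} x∈Sc) (member {c + s} x∈Sc+s)
    where
    member : ∀ {c} → x ∈ circular c → member? c (toℕ x) ≡ true
    member {c} x∈Sc = b2n-injective (trans (sym (ind-circular c (toℕ x))) (∈⇒ind≡1 (circular c) x x∈Sc))

  circular-periodic : ∀ c → circular (c + n) ≡ circular c
  circular-periodic c = VP.tabulate-cong λ i → cong (λ z → n ≤ᵇ z + k)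
    (trans (pos-+ c n (toℕ i)) (trans ([m+n]%n≡m%n (pos c (toℕ i)) n) (m%n%n≡m%n (c + k * toℕ i) n)))

Deleted : (n k : ℕ) → Subset n → Subset n → Set
Deleted n k v S = SGVertex n k S × S ≢ v

module LowerBound (n-1 k : ℕ) (1≤k : 1 ≤ k) (2k≤n : 2 * k ≤ suc n-1) where
  open Cyclic n-1
  open Circular n-1 k 2k≤n

  circular-colouring-bound : (P : Subset n → Set) → (∀ c → P (circular c)) →
    ∀ a b → Colorable n P a b → n * b ≤ a * k
  circular-colouring-bound P P-circular a b (col , col-size , col-proper) = begin
      n * b                                                  ≡⟨ sym (sumFrom-≡-const _ 0 n b λ c _ → sizes c) ⟩
      sumFrom (λ c → sumFrom (has-colour c) 0 a) 0 n               ≡⟨ sumFrom-comm has-colour a 0 n ⟩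
      sumFrom (λ γ → sumFrom (λ c → has-colour c γ) 0 n) 0 a       ≤⟨ sumFrom-≤-const _ 0 a k colour-class-bound ⟩
      a * k                                                  ∎
    where
    open ≤-Reasoning
    has-colour : ℕ → ℕ → ℕ
    has-colour c = bitAt (col (circular c))
    sizes : ∀ c → sumFrom (has-colour c) 0 a ≡ b
    sizes c = trans (sym (∣∣≡sumFrom-bitAt (col (circular c)))) (col-size _ (P-circular c))
    colour-class-bound : ∀ γ → γ < a → sumFrom (λ c → has-colour c γ) 0 n ≤ k
    colour-class-bound γ γ<a = katona n k 1≤k k+k≤n (λ c → has-colour c γ) (λ c → bitAt-binary (col (circular c)) γ)
      (λ c → cong (λ U → bitAt (col U) γ) (circular-periodic c))
      λ c s k≤s s+k≤n → binary-disjoint _ _ (bitAt-binary (col (circular c)) γ) (bitAt-binary (col (circular (c + s))) γ)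
        λ p q →
        col-proper (circular c) (circular (c + s)) (P-circular c) (P-circular (c + s)) (circular-disjoint c s k≤s s+k≤n)
          (fromℕ< γ<a) (bitAt≡1⇒∈ (col (circular c)) γ<a p) (bitAt≡1⇒∈ (col (circular (c + s))) γ<a q)

  identity-colouring : Colorable n (SGVertex n k) n k
  identity-colouring = (λ S → S) , (λ S v → proj₁ v) , (λ S T _ _ d → d)

  colouring⇒χf-drop : ∀ v a b → 1 ≤ b → Colorable n (Deleted n k v) a b → a * k < n * b →
    FracChiLt n (Deleted n k v) (SGVertex n k)
  colouring⇒χf-drop v a b 1≤b col ak<nb = a , b , 1≤b , col , λ a' b' 1≤b' col' →
    cross-<-≤ a b n k a' b' 1≤b' ak<nb (circular-colouring-bound (SGVertex n k) circular-vertex a' b' col')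

  noncircular-deletion-keeps-χf : ∀ v → (∀ c → circular c ≢ v) → ¬ FracChiLt n (Deleted n k v) (SGVertex n k)
  noncircular-deletion-keeps-χf v noncircular (a , b , _ , col , better) =
    <⇒≱ (better n k 1≤k identity-colouring)
        (circular-colouring-bound (Deleted n k v) (λ c → circular-vertex c , noncircular c) a b col)

module Crowded (n-1 k : ℕ) (2≤k : 2 ≤ k) (room : suc (suc (2 * k)) ≤ suc n-1) where
  open Cyclic n-1

  2k<n : 2 * k < n
  2k<n = ≤-trans (n≤1+n _) room

  open Circular n-1 k (<⇒≤ 2k<n)
  open LowerBound n-1 k (≤-trans (s≤s z≤n) 2≤k) (<⇒≤ 2k<n)

  crowded? : ℕ → Bool
  crowded? y = isEven y ∧ does (y <? 2 * k)

  crowded : Subset n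
  crowded = subsetℕ n crowded?

  4≤2k : 4 ≤ 2 * k
  4≤2k = *-monoʳ-≤ 2 2≤k

  ind-crowded : ∀ y → y < n → ind crowded y ≡ b2n (crowded? y)
  ind-crowded y y<n = trans (ind-< crowded y y<n) (bitAt-subsetℕ n crowded? y y<n)

  crowded?-< : ∀ y → y < 2 * k → crowded? y ≡ isEven y
  crowded?-< y y<2k rewrite dec-true (y <? 2 * k) y<2k = BP.∧-identityʳ (isEven y)

  crowded?-≥ : ∀ y → 2 * k ≤ y → crowded? y ≡ false
  crowded?-≥ y 2k≤y rewrite dec-false (y <? 2 * k) (≤⇒≯ 2k≤y) = BP.∧-zeroʳ (isEven y)

  crowded?-sparse : ∀ y → b2n (crowded? y) + b2n (crowded? (suc y)) ≤ 1
  crowded?-sparse y = ≤-trans (+-mono-≤ (b2n-∧-≤ (isEven y) _) (b2n-∧-≤ (isEven (suc y)) _)) (alternating-sparse y)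

  crowded-sparse : Sparse (ind crowded)
  crowded-sparse = sparse-on-period⇒sparse crowded λ z z<n → pair z z<n (z <? 2 * k)
    where
    pair : ∀ z → z < n → Dec (z < 2 * k) → ind crowded z + ind crowded (suc z) ≤ 1
    pair z z<n (yes z<2k) = subst₂ (λ a b → a + b ≤ 1)
      (sym (ind-crowded z z<n)) (sym (ind-crowded (suc z) (<-≤-trans (s≤s z<2k) 2k<n))) (crowded?-sparse z)
    pair z z<n (no z≮2k) = subst (λ a → a + ind crowded (suc z) ≤ 1)
      (sym (trans (ind-crowded z z<n) (cong b2n (crowded?-≥ z (≮⇒≥ z≮2k))))) (ind-binary crowded (suc z))

  crowded-size : ∣ crowded ∣ ≡ k
  crowded-size = begin
      ∣ crowded ∣                                                   ≡⟨ ∣∣≡period-sum crowded ⟩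
      sumFrom f 0 n                                                 ≡⟨ cong (sumFrom f 0) (sym (m+[n∸m]≡n (<⇒≤ 2k<n))) ⟩
      sumFrom f 0 (2 * k + (n ∸ 2 * k))                             ≡⟨ sumFrom-+ f 0 (2 * k) (n ∸ 2 * k) ⟩
      sumFrom f 0 (2 * k) + sumFrom f (2 * k) (n ∸ 2 * k)           ≡⟨ cong₂ _+_ evens nothing-after ⟩
      k + (n ∸ 2 * k) * 0                                           ≡⟨ cong (k +_) (*-zeroʳ (n ∸ 2 * k)) ⟩
      k + 0                                                         ≡⟨ +-identityʳ k ⟩
      k                                                             ∎
    where
    open ≡-Reasoning
    f = ind crowded
    evens : sumFrom f 0 (2 * k) ≡ k
    evens = trans (sumFrom-cong f alternating 0 0 (2 * k) λ j j<2k →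
        trans (ind-crowded j (<-trans j<2k 2k<n)) (cong b2n (crowded?-< j j<2k)))
      (sumFrom-alternating k)
    nothing-after : sumFrom f (2 * k) (n ∸ 2 * k) ≡ (n ∸ 2 * k) * 0
    nothing-after = sumFrom-≡-const f (2 * k) (n ∸ 2 * k) 0 λ j j< →
      trans (ind-crowded (2 * k + j) (subst (2 * k + j <_) (m+[n∸m]≡n (<⇒≤ 2k<n)) (+-monoʳ-< (2 * k) j<)))
            (cong b2n (crowded?-≥ (2 * k + j) (m≤m+n (2 * k) j)))

  crowded-vertex : SGVertex n k crowded
  crowded-vertex = crowded-size , sparse⇒separated crowded crowded-sparse

  top : ℕ
  top = 2 * (k ∸ 1)

  top+2≡2k : suc (suc top) ≡ 2 * k
  top+2≡2k = trans (sym (2*suc (k ∸ 1))) (cong (2 *_) (trans (+-comm 1 (k ∸ 1)) (m∸n+n≡m (≤-trans (s≤s z≤n) 2≤k))))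

  top+1<2k : suc top < 2 * k
  top+1<2k = ≤-reflexive top+2≡2k

  ind-beyond-top : ∀ j → j < 2 → ind crowded (j + suc (suc top)) ≡ 0
  ind-beyond-top j j<2 = trans (ind-crowded _ (subst (_< n) (sym j+top+2≡j+2k) (<-≤-trans (+-monoˡ-< (2 * k) j<2) room)))
    (cong b2n (crowded?-≥ _ (subst (2 * k ≤_) (sym j+top+2≡j+2k) (m≤n+m (2 * k) j))))
    where
    j+top+2≡j+2k : j + suc (suc top) ≡ j + 2 * k
    j+top+2≡j+2k = cong (j +_) top+2≡2k

  crowded-not-well-spread : ¬ WellSpread n crowded
  crowded-not-well-spread ws =
    1+n≰n (subst₂ (λ a b → a ≤ suc b) dense empty (well-spread⇒balanced crowded ws 0 (suc top) 3 (s≤s z≤n) 3≤n-1))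
    where
    3≤n-1 : 3 ≤ n ∸ 1
    3≤n-1 = ≤-trans (≤-trans (n≤1+n 3) 4≤2k) (≤-trans (n≤1+n _) (s≤s⁻¹ room))
    dense : sumFrom (ind crowded) 0 3 ≡ 2
    dense = sumFrom-cong (ind crowded) alternating 0 0 3 λ j j<3 →
      let j<2k = <-≤-trans j<3 (≤-trans (n≤1+n 3) 4≤2k) in
      trans (ind-crowded j (<-trans j<2k 2k<n)) (cong b2n (crowded?-< j j<2k))
    empty : sumFrom (ind crowded) (suc top) 3 ≡ 0
    empty = cong₂ _+_
      (trans (ind-crowded (suc top) (<-trans top+1<2k 2k<n)) (cong b2n (trans (crowded?-< (suc top) top+1<2k) (isEven-odd (k ∸ 1)))))
      (sumFrom-≡-const (ind crowded) (suc (suc top)) 2 0 λ j j<2 →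
        trans (cong (ind crowded) (+-comm (suc (suc top)) j)) (ind-beyond-top j j<2))

  -- 0 and 2 are members, which forces n < 3k; top is followed by two non-members, which forces 3k < n.
  crowded-not-circular : ∀ c → circular c ≢ crowded
  crowded-not-circular c circular≡crowded = <-asym
    (members-two-apart⇒n<3k c 0 (member-at-even 0 (<-trans (s≤s z≤n) 2<2k)) (member-at-even 1 2<2k))
    (isolated-member⇒3k<n c top (member-at-even (k ∸ 1) (<-trans (n<1+n top) top+1<2k))
      (non-member-beyond-top 0 (s≤s z≤n)) (non-member-beyond-top 1 (s≤s (s≤s z≤n))))
    where
    mark≡ind : ∀ y → mark c y ≡ ind crowded y
    mark≡ind y = trans (sym (ind-circular c y)) (cong (λ U → ind U y) circular≡crowded)
    member-at-even : ∀ j → 2 * j < 2 * k → member? c (2 * j) ≡ true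
    member-at-even j 2j<2k = b2n-injective (trans (mark≡ind (2 * j))
      (trans (ind-crowded (2 * j) (<-trans 2j<2k 2k<n)) (cong b2n (trans (crowded?-< _ 2j<2k) (isEven-even j)))))
    non-member-beyond-top : ∀ j → j < 2 → member? c (j + suc (suc top)) ≡ false
    non-member-beyond-top j j<2 = b2n-injective (trans (mark≡ind _) (ind-beyond-top j j<2))
    2<2k : 2 < 2 * k
    2<2k = <-≤-trans (s≤s (s≤s (s≤s z≤n))) 4≤2k

  crowded-deletion-keeps-χf : ¬ FracChiLt n (Deleted n k crowded) (SGVertex n k)
  crowded-deletion-keeps-χf = noncircular-deletion-keeps-χf crowded crowded-not-circular

  ¬QEqualsSG : ¬ QEqualsSG n k
  ¬QEqualsSG Q≡SG = crowded-not-well-spread (proj₂ (Q≡SG crowded crowded-vertex))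

  ¬FracVertexCritical : ¬ FracVertexCritical n k
  ¬FracVertexCritical critical = crowded-deletion-keeps-χf (critical crowded crowded-vertex)

module Clique (n-1 : ℕ) (2≤n : 2 ≤ suc n-1) where
  open Cyclic n-1
  open LowerBound n-1 1 (s≤s z≤n) 2≤n

  module _ (v : Subset n) (v-vertex : SGVertex n 1 v) where

    element : ∃ λ p → p < n × 0 < ind v (0 + p)
    element = sumFrom>0⇒∃ (ind v) 0 n (subst (0 <_) (sym (vertex-window-sum v v-vertex 0)) z<s)

    p = proj₁ element

    rest-empty : ∀ U → SGVertex n 1 U → ind U p ≡ 1 → sumFrom (ind U) (suc p) n-1 ≡ 0
    rest-empty U U-vertex Up≡1 = +-cancelˡ-≡ 1 _ _
      (trans (cong (_+ sumFrom (ind U) (suc p) n-1) (sym Up≡1)) (vertex-window-sum U U-vertex p))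

    only-v-at-p : ∀ U → SGVertex n 1 U → ind U p ≡ 1 → U ≡ v
    only-v-at-p U U-vertex Up≡1 = gap-determines-vertex 0 n-1 (suc p) U v U-vertex v-vertex (+-comm n-1 1)
      (rest-empty U U-vertex Up≡1) (rest-empty v v-vertex (binary-pos⇒≡1 (ind-binary v p) (proj₂ (proj₂ element))))

    -- The vertices other than v are the singletons {y} with y ≢ p (mod n); {p + 1 + j} gets colour j.
    colour : Subset n → Subset n-1
    colour S = subsetℕ n-1 (λ j → 1 ≤ᵇ ind S (suc p + j))

    ind-colour : ∀ S j → j < n-1 → bitAt (colour S) j ≡ ind S (suc p + j)
    ind-colour S j j<n-1 = trans (bitAt-subsetℕ n-1 _ j j<n-1) (b2n-1≤ᵇ (ind-binary S (suc p + j)))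

    colouring : Colorable n (Deleted n 1 v) n-1 1
    colouring = colour , size , proper
      where
      size : ∀ S → Deleted n 1 v S → ∣ colour S ∣ ≡ 1
      size S (S-vertex , S≢v) = begin
          ∣ colour S ∣                      ≡⟨ ∣∣≡sumFrom-bitAt (colour S) ⟩
          sumFrom (bitAt (colour S)) 0 n-1  ≡⟨ sumFrom-cong _ _ 0 (suc p) n-1 (ind-colour S) ⟩
          sumFrom (ind S) (suc p) n-1       ≡⟨ trans (cong (_+ sumFrom (ind S) (suc p) n-1) (sym Sp≡0)) (vertex-window-sum S S-vertex p) ⟩
          1                                 ∎
        where
        open ≡-Reasoning
        Sp≡0 : ind S p ≡ 0
        Sp≡0 with n≤1⇒n≡0∨n≡1 (ind-binary S p)
        ... | inj₁ Sp≡0 = Sp≡0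
        ... | inj₂ Sp≡1 = ⊥-elim (S≢v (only-v-at-p S S-vertex Sp≡1))
      proper : ∀ S T → Deleted n 1 v S → Deleted n 1 v T → Disjoint S T → Disjoint (colour S) (colour T)
      proper S T _ _ S∩T≡∅ x x∈S x∈T = disjoint⇒¬both S T S∩T≡∅ (suc p + toℕ x) (at S x∈S) (at T x∈T)
        where
        at : ∀ U → x ∈ colour U → ind U (suc p + toℕ x) ≡ 1
        at U x∈U = trans (sym (ind-colour U (toℕ x) (FP.toℕ<n x))) (trans (bitAt-toℕ (colour U) x) (cong b2n (VP.[]=⇒lookup x∈U)))

    critical-at : FracChiLt n (Deleted n 1 v) (SGVertex n 1)
    critical-at = colouring⇒χf-drop v n-1 1 ≤-refl colouring
      (subst₂ _<_ (sym (*-identityʳ n-1)) (sym (*-identityʳ n)) (n<1+n n-1))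

  critical : FracVertexCritical n 1
  critical = critical-at

module Edge (k-1 : ℕ) where
  open Cyclic (suc (2 * k-1))
  open LowerBound (suc (2 * k-1)) (suc k-1) (s≤s z≤n) (≤-reflexive (2*suc k-1))

  module _ (v : Subset n) (v-vertex : SGVertex n (suc k-1) v) where

    hole : ∃ λ p → ind v p ≡ 0
    hole with n≤1⇒n≡0∨n≡1 (ind-binary v 0)
    ... | inj₁ v0≡0 = 0 , v0≡0
    ... | inj₂ v0≡1 = 1 , n≤0⇒n≡0 (+-cancelˡ-≤ 1 _ _ (subst (λ a → a + ind v 1 ≤ 1) v0≡1 (vertex-sparse v v-vertex 0)))

    p = proj₁ hole

    others-contain-p : ∀ S → Deleted n (suc k-1) v S → ind S p ≡ 1
    others-contain-p S (S-vertex , S≢v) with n≤1⇒n≡0∨n≡1 (ind-binary S p)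
    ... | inj₂ Sp≡1 = Sp≡1
    ... | inj₁ Sp≡0 = ⊥-elim (S≢v (gap-determines-vertex k-1 1 p S v S-vertex v-vertex refl
                        (cong (_+ 0) Sp≡0) (cong (_+ 0) (proj₂ hole))))

    colouring : Colorable n (Deleted n (suc k-1) v) 1 1
    colouring = (λ _ → ⁅ F.zero {n = 0} ⁆) , (λ _ _ → ∣⁅x⁆∣≡1 {n = 1} F.zero) , λ S T S-del T-del S∩T≡∅ →
      ⊥-elim (disjoint⇒¬both S T S∩T≡∅ p (others-contain-p S S-del) (others-contain-p T T-del))

    critical-at : FracChiLt n (Deleted n (suc k-1) v) (SGVertex n (suc k-1))
    critical-at = colouring⇒χf-drop v 1 1 ≤-refl colouring
      (subst₂ _<_ (sym (*-identityˡ (suc k-1))) (sym (*-identityʳ n)) (s≤s (s≤s (m≤m+n k-1 _))))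

  critical : FracVertexCritical n (suc k-1)
  critical = critical-at

module OddCycle (k-1 : ℕ) where
  open Cyclic (2 * suc k-1)
  open LowerBound (2 * suc k-1) (suc k-1) (s≤s z≤n) (n≤1+n _)

  module _ (v : Subset n) (v-vertex : SGVertex n (suc k-1) v) where

    double-hole : ∃ λ z → sumFrom (ind v) z 2 ≡ 0
    double-hole with sumFrom<length⇒∃ (λ y → ind v y + ind v (suc y)) 0 n pair-sum<n
      where
      pair-sum<n : sumFrom (λ y → ind v y + ind v (suc y)) 0 n < n
      pair-sum<n = begin-strict
        sumFrom (λ y → ind v y + ind v (suc y)) 0 n   ≡⟨ sumFrom-distrib (ind v) (λ y → ind v (suc y)) 0 n ⟩
        sumFrom (ind v) 0 n + sumFrom (λ y → ind v (suc y)) 0 n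
                                                      ≡⟨ cong (sumFrom (ind v) 0 n +_) (sumFrom-cong _ (ind v) 0 1 n (λ _ _ → refl)) ⟩
        sumFrom (ind v) 0 n + sumFrom (ind v) 1 n     ≡⟨ cong₂ _+_ (vertex-window-sum v v-vertex 0) (vertex-window-sum v v-vertex 1) ⟩
        suc k-1 + suc k-1                             ≡⟨ cong (suc k-1 +_) (sym (+-identityʳ (suc k-1))) ⟩
        2 * suc k-1                                   <⟨ n<1+n _ ⟩
        n                                             ∎
        where open ≤-Reasoning
    ... | z , _ , e = z , trans (cong (ind v z +_) (+-identityʳ _)) e

    module _ (z : ℕ) (v-hole : sumFrom (ind v) z 2 ≡ 0) where

      others-meet-z-or-next : ∀ S → Deleted n (suc k-1) v S → ind S z ≡ 0 → ind S (suc z) ≡ 1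
      others-meet-z-or-next S (S-vertex , S≢v) Sz≡0 with n≤1⇒n≡0∨n≡1 (ind-binary S (suc z))
      ... | inj₂ Sz+1≡1 = Sz+1≡1
      ... | inj₁ Sz+1≡0 = ⊥-elim (S≢v (gap-determines-vertex k-1 2 z S v S-vertex v-vertex (cong suc (sym (2*suc k-1)))
                            (cong₂ (λ a b → a + (b + 0)) Sz≡0 Sz+1≡0) v-hole))

      -- Two vertices other than v that both miss z both contain z + 1.
      colour : Subset n → Subset 2
      colour S = ⁅ fromℕ< (s≤s (ind-binary S z)) ⁆

      colouring : Colorable n (Deleted n (suc k-1) v) 2 1
      colouring = colour , (λ S _ → ∣⁅x⁆∣≡1 (fromℕ< (s≤s (ind-binary S z)))) , proper
        where
        same-colour : ∀ S T {x} → x ∈ colour S → x ∈ colour T → ind S z ≡ ind T z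
        same-colour S T x∈S x∈T = trans (sym (FP.toℕ-fromℕ< (s≤s (ind-binary S z))))
          (trans (cong toℕ (trans (sym (x∈⁅y⁆⇒x≡y _ x∈S)) (x∈⁅y⁆⇒x≡y _ x∈T))) (FP.toℕ-fromℕ< (s≤s (ind-binary T z))))
        proper : ∀ S T → Deleted n (suc k-1) v S → Deleted n (suc k-1) v T → Disjoint S T → Disjoint (colour S) (colour T)
        proper S T S-del T-del S∩T≡∅ x x∈S x∈T with n≤1⇒n≡0∨n≡1 (ind-binary S z)
        ... | inj₂ Sz≡1 = disjoint⇒¬both S T S∩T≡∅ z Sz≡1 (trans (sym (same-colour S T x∈S x∈T)) Sz≡1)
        ... | inj₁ Sz≡0 = disjoint⇒¬both S T S∩T≡∅ (suc z) (others-meet-z-or-next S S-del Sz≡0)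
                            (others-meet-z-or-next T T-del (trans (sym (same-colour S T x∈S x∈T)) Sz≡0))

    critical-at : FracChiLt n (Deleted n (suc k-1) v) (SGVertex n (suc k-1))
    critical-at = colouring⇒χf-drop v 2 1 ≤-refl (colouring (proj₁ double-hole) (proj₂ double-hole))
      (subst (2 * suc k-1 <_) (sym (*-identityʳ n)) (n<1+n _))

  critical : FracVertexCritical n (suc k-1)
  critical = critical-at

Exceptional : ℕ → ℕ → Set
Exceptional n k = k ≡ 1 ⊎ n ≡ 2 * k ⊎ n ≡ suc (2 * k)

exceptional-or-crowded : ∀ n k → 1 ≤ k → 2 * k ≤ n → Exceptional n k ⊎ (2 ≤ k × suc (suc (2 * k)) ≤ n)
exceptional-or-crowded n k 1≤k 2k≤n with k ≟ 1 | n ≟ 2 * k | n ≟ suc (2 * k)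
... | yes k≡1 | _         | _           = inj₁ (inj₁ k≡1)
... | no _    | yes n≡2k  | _           = inj₁ (inj₂ (inj₁ n≡2k))
... | no _    | no _      | yes n≡2k+1  = inj₁ (inj₂ (inj₂ n≡2k+1))
... | no k≢1  | no n≢2k   | no n≢2k+1   =
  inj₂ (≤∧≢⇒< 1≤k (k≢1 ∘ sym) , ≤∧≢⇒< (≤∧≢⇒< 2k≤n (n≢2k ∘ sym)) (n≢2k+1 ∘ sym))

exceptional⇒Q≡SG : ∀ n-1 k → Exceptional (suc n-1) k → QEqualsSG (suc n-1) k
exceptional⇒Q≡SG n-1 k (inj₁ refl)           S v = v , Cyclic.singleton-well-spread n-1 S v
exceptional⇒Q≡SG n-1 k (inj₂ (inj₁ n≡2k))    S v =
  v , Cyclic.half-well-spread n-1 S (trans (cong ⌊_/2⌋ n≡2k) (⌊2*n/2⌋≡n k)) v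
exceptional⇒Q≡SG n-1 k (inj₂ (inj₂ n≡2k+1))  S v =
  v , Cyclic.half-well-spread n-1 S (trans (cong ⌊_/2⌋ n≡2k+1) (⌊1+2*n/2⌋≡n k)) v

exceptional⇒critical : ∀ n-1 k → 1 ≤ k → 2 * k ≤ suc n-1 → Exceptional (suc n-1) k →
  FracVertexCritical (suc n-1) k
exceptional⇒critical n-1 k         _ 2≤n (inj₁ refl)          = Clique.critical n-1 2≤n
exceptional⇒critical n-1 (suc k-1) _ _   (inj₂ (inj₁ n≡2k)) with suc-injective (trans n≡2k (2*suc k-1))
... | refl = Edge.critical k-1
exceptional⇒critical _   (suc k-1) _ _   (inj₂ (inj₂ refl))   = OddCycle.critical k-1

corollary21 : (n k : ℕ) → 1 ≤ k → 2 * k ≤ n →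
    (QEqualsSG n k ⇔ (k ≡ 1 ⊎ n ≡ 2 * k ⊎ n ≡ suc (2 * k)))
    × (FracVertexCritical n k ⇔ (k ≡ 1 ⊎ n ≡ 2 * k ⊎ n ≡ suc (2 * k)))
corollary21 zero      zero    () _
corollary21 zero      (suc k) _  ()
corollary21 (suc n-1) k 1≤k 2k≤n =
  mk⇔ (exceptional-unless (Crowded.¬QEqualsSG n-1 k)) (exceptional⇒Q≡SG n-1 k) ,
  mk⇔ (exceptional-unless (Crowded.¬FracVertexCritical n-1 k)) (exceptional⇒critical n-1 k 1≤k 2k≤n)
  where
  exceptional-unless : ∀ {X : Set} → (2 ≤ k → suc (suc (2 * k)) ≤ suc n-1 → X → ⊥) → X → Exceptional (suc n-1) k
  exceptional-unless ¬X x with exceptional-or-crowded (suc n-1) k 1≤k 2k≤n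
  ... | inj₁ exceptional       = exceptional
  ... | inj₂ (2≤k , room)      = ⊥-elim (¬X 2≤k room x)
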